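{- Let $\mathcal{F}$ be a finite family of closed intervals on a line $\ell$ and let $G$ be the intersection graph of $\mathcal{F}$. Then $G$ admits a closed conflict-free coloring with 3 colors.
   Context: The intersection graph of $\mathcal{F}$ has vertex set $\mathcal{F}$, two intervals adjacent iff they intersect. For $v$ a vertex, $N_G[v]$ denotes $v$ together with its neighbors. A closed conflict-free coloring is a vertex coloring such that for every vertex $v$ the set $N_G[v]$ contains a vertex whose color differs from the colors of all other vertices of $N_G[v]$.
   Formalization: The closed intervals on the line ℓ have rational endpoints. -}

module Defs where

open import Data.Nat using (ℕ)
open import Data.Fin using (Fin)
open import Data.Rational using (ℚ; _≤_)
open import Data.Product using (Σ; _×_)
open import Data.Sum using (_⊎_)
open import Relation.Binary.PropositionalEquality using (_≡_; _≢_)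

record Interval : Set where
  constructor [_,_]⟨_⟩
  field
    lo : ℚ
    hi : ℚ
    lo≤hi : lo ≤ hi
open Interval public

-- Closed intervals [a,b] and [c,d] share a point iff a ≤ d and c ≤ b.
Intersect : Interval → Interval → Set
Intersect I J = (lo I ≤ hi J) × (lo J ≤ hi I)

Family : ℕ → Set
Family n = Fin n → Interval

Adj : ∀ {n} → Family n → Fin n → Fin n → Set
Adj F u v = u ≢ v × Intersect (F u) (F v)

InClosedNbhd : ∀ {n} → Family n → Fin n → Fin n → Set
InClosedNbhd F v u = (u ≡ v) ⊎ Adj F u v

ClosedConflictFree : ∀ {n} (k : ℕ) → Family n → (Fin n → Fin k) → Set
ClosedConflictFree {n} k F c =
  (v : Fin n) → Σ (Fin n) λ u → InClosedNbhd F v u ×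
    ((w : Fin n) → InClosedNbhd F v w → w ≢ u → c w ≢ c u)

{-# OPTIONS --safe #-}
module Submission where

-- Sweep the intervals by increasing left endpoint, with colour 0 as a blank. The
-- coloured intervals form a greedy chain covering the union in which consecutive
-- members have different colours and every interval meets at most three consecutive
-- members, so it sees a member whose colour is unique in its closed neighbourhood.
-- A new interval x, starting after all others, can only meet the last two members,
-- last and prev: if x does not reach beyond last it stays blank; otherwise it is
-- appended to the chain, or, when x already meets prev, it replaces last, which is
-- blanked.

open import Defs
open import Data.Nat using (ℕ; zero; suc)
open import Data.Fin using (Fin; zero; suc; _≟_)
open import Data.Fin.Properties using (suc-injective)
open import Data.Fin.Permutation
  using (Permutation′; _⟨$⟩ʳ_; _⟨$⟩ˡ_; inverseˡ; inverseʳ; id; transpose; lift₀; _∘ₚ_)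
open import Data.Vec.Functional using (_∷_; updateAt)
open import Data.Vec.Functional.Properties using (updateAt-updates; updateAt-minimal)
open import Data.Product using (Σ; ∃; _×_; _,_; proj₁; proj₂)
open import Data.Sum using (_⊎_; inj₁; inj₂) renaming (map to ⊎-map)
open import Data.Unit.Polymorphic using (⊤)
open import Data.Empty using (⊥-elim)
open import Data.Rational using (ℚ; _≤_; _<_)
open import Data.Rational.Properties
  using (≤-refl; ≤-trans; <⇒≤; ≰⇒>; <-irrefl; ≤-<-trans; <-≤-trans; _≤?_; ≤-totalPreorder)
open import Function using (_∘_)
open import Relation.Binary.Bundles using (TotalPreorder)
open import Relation.Nullary using (¬_; yes; no)
open import Relation.Binary.PropositionalEquality using (_≡_; _≢_; refl; sym; trans; cong; subst)

module _ {a ℓ₁ ℓ₂} (O : TotalPreorder a ℓ₁ ℓ₂) where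
  open TotalPreorder O using (Carrier; _≲_; total) renaming (refl to ≲-refl; trans to ≲-trans)

  argmax : ∀ {n} (f : Fin (suc n) → Carrier) → ∃ λ i → ∀ j → f j ≲ f i
  argmax {zero} f = zero , λ { zero → ≲-refl }
  argmax {suc n} f with argmax (f ∘ suc)
  ... | i , max with total (f (suc i)) (f zero)
  ...   | inj₁ i≲0 = zero , λ { zero → ≲-refl ; (suc j) → ≲-trans (max j) i≲0 }
  ...   | inj₂ 0≲i = suc i , λ { zero → 0≲i ; (suc j) → max j }

  Descending : ∀ {n} → (Fin n → Carrier) → Set ℓ₂
  Descending {zero} f = ⊤
  Descending {suc n} f = (∀ i → f i ≲ f zero) × Descending (f ∘ suc)

  sortDescending : ∀ {n} (f : Fin n → Carrier) →
                   ∃ λ (π : Permutation′ n) → Descending (f ∘ (π ⟨$⟩ʳ_))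
  sortDescending {zero} f = id , _
  sortDescending {suc n} f with argmax f
  ... | i , max with sortDescending (f ∘ (transpose zero i ⟨$⟩ʳ_) ∘ suc)
  ...   | π , sorted = lift₀ π ∘ₚ transpose zero i , (λ j → max _) , sorted

≤⇒≯ : ∀ {p q : ℚ} → p ≤ q → ¬ q < p
≤⇒≯ p≤q q<p = <-irrefl refl (≤-<-trans p≤q q<p)

otherColour : Fin 3 → Fin 3
otherColour zero = suc zero
otherColour (suc zero) = suc (suc zero)
otherColour (suc (suc zero)) = suc zero

otherColour≢0 : ∀ a → otherColour a ≢ zero
otherColour≢0 zero ()
otherColour≢0 (suc zero) ()
otherColour≢0 (suc (suc zero)) ()

otherColour≢ : ∀ a → otherColour a ≢ a
otherColour≢ zero ()
otherColour≢ (suc zero) ()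
otherColour≢ (suc (suc zero)) ()

nonzero-colour-cases : (a b d : Fin 3) → a ≢ zero → b ≢ zero → a ≢ b → d ≢ zero → d ≡ a ⊎ d ≡ b
nonzero-colour-cases zero b d a≢0 _ _ _ = ⊥-elim (a≢0 refl)
nonzero-colour-cases a zero d _ b≢0 _ _ = ⊥-elim (b≢0 refl)
nonzero-colour-cases a b zero _ _ _ d≢0 = ⊥-elim (d≢0 refl)
nonzero-colour-cases (suc zero) (suc zero) d _ _ a≢b _ = ⊥-elim (a≢b refl)
nonzero-colour-cases (suc (suc zero)) (suc (suc zero)) d _ _ a≢b _ = ⊥-elim (a≢b refl)
nonzero-colour-cases (suc zero) (suc (suc zero)) (suc zero) _ _ _ _ = inj₁ refl
nonzero-colour-cases (suc zero) (suc (suc zero)) (suc (suc zero)) _ _ _ _ = inj₂ refl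
nonzero-colour-cases (suc (suc zero)) (suc zero) (suc zero) _ _ _ _ = inj₂ refl
nonzero-colour-cases (suc (suc zero)) (suc zero) (suc (suc zero)) _ _ _ _ = inj₁ refl

blank : ∀ {n} → Fin n → (Fin n → Fin 3) → Fin n → Fin 3
blank t c = updateAt c t (λ _ → zero)

blank-≢0 : ∀ {n} {w : Fin n} (t : Fin n) (c : Fin n → Fin 3) →
           blank t c w ≢ zero → w ≢ t × blank t c w ≡ c w
blank-≢0 {w = w} t c b≢0 with w ≟ t
... | yes refl = ⊥-elim (b≢0 (updateAt-updates t c))
... | no w≢t = w≢t , updateAt-minimal w t c w≢t

Meets : ∀ {n} → Family n → Fin n → Fin n → Set
Meets F w v = Intersect (F w) (F v)

Meets-refl : ∀ {n} (F : Family n) v → Meets F v v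
Meets-refl F v = lo≤hi (F v) , lo≤hi (F v)

ends-before⇒¬Meets : ∀ {n} (F : Family n) {v w} → hi (F v) < lo (F w) → ¬ Meets F w v
ends-before⇒¬Meets F v<w (w≤v , _) = ≤⇒≯ w≤v v<w

-- Colour zero is a blank: since witnesses are nonzero, blank intervals never spoil one.
Witness : ∀ {n} → Family n → (Fin n → Fin 3) → Fin n → Fin n → Set
Witness F c v u = Meets F u v × c u ≢ zero × (∀ w → Meets F w v → w ≢ u → c w ≢ c u)

witness⇒closedConflictFree : ∀ {n} (F : Family n) (c : Fin n → Fin 3) →
  (∀ v → ∃ (Witness F c v)) → ClosedConflictFree 3 F c
witness⇒closedConflictFree F c witness v with witness v
... | u , u-meets , _ , unique = u , neighbour , λ w w∈N[v] → unique w (meets w w∈N[v])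
  where
  neighbour : InClosedNbhd F v u
  neighbour with u ≟ v
  ... | yes u≡v = inj₁ u≡v
  ... | no u≢v = inj₂ (u≢v , u-meets)
  meets : ∀ w → InClosedNbhd F v w → Meets F w v
  meets w (inj₁ refl) = Meets-refl F w
  meets w (inj₂ (_ , w-meets)) = w-meets

onImage : ∀ {n} (π : Permutation′ n) {P : Fin n → Set} → (∀ k → P (π ⟨$⟩ʳ k)) → ∀ k → P k
onImage π {P} p k = subst P (inverseʳ π) (p (π ⟨$⟩ˡ k))

witness-relabel : ∀ {n} (π : Permutation′ n) (F : Family n) (c : Fin n → Fin 3) →
  (∀ v → ∃ (Witness (F ∘ (π ⟨$⟩ʳ_)) c v)) → ∀ v → ∃ (Witness F (c ∘ (π ⟨$⟩ˡ_)) v)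
witness-relabel π F c witness = onImage π λ v →
  let (u , u-meets , u≢0 , unique) = witness v in
  π ⟨$⟩ʳ u , u-meets , u≢0 ∘ trans (sym (colour-π u)) ,
  onImage π λ w w-meets w≢u cw≡cu →
    unique w w-meets (w≢u ∘ cong (π ⟨$⟩ʳ_)) (trans (sym (colour-π w)) (trans cw≡cu (colour-π u)))
  where
  colour-π : ∀ k → c (π ⟨$⟩ˡ (π ⟨$⟩ʳ k)) ≡ c k
  colour-π k = cong c (inverseˡ π)

witness-blank : ∀ {n} (F : Family n) (c : Fin n → Fin 3) {t v u} →
  u ≢ t → Witness F c v u → Witness F (blank t c) v u
witness-blank F c {t} {v} {u} u≢t (u-meets , u≢0 , unique) =
  u-meets , subst (_≢ zero) (sym blank-u) u≢0 ,
  λ w w-meets w≢u → subst (blank t c w ≢_) (sym blank-u) (unique′ w w-meets w≢u)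
  where
  blank-u : blank t c u ≡ c u
  blank-u = updateAt-minimal u t c u≢t
  unique′ : ∀ w → Meets F w v → w ≢ u → blank t c w ≢ c u
  unique′ w w-meets w≢u bw≡cu with blank-≢0 t c (λ bw≡0 → u≢0 (trans (sym bw≡cu) bw≡0))
  ... | _ , bw≡cw = unique w w-meets w≢u (trans (sym bw≡cw) bw≡cu)

witness-lift-disjoint : ∀ {n} (F : Family (suc n)) a (c : Fin n → Fin 3) {v u} →
  ¬ Meets F zero (suc v) → Witness (F ∘ suc) c v u → Witness F (a ∷ c) (suc v) (suc u)
witness-lift-disjoint F a c disjoint (u-meets , u≢0 , unique) = u-meets , u≢0 , λ
  { zero meets _ _ → disjoint meets
  ; (suc w) w-meets w≢u → unique w w-meets (w≢u ∘ cong suc) }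

witness-lift-blank : ∀ {n} (F : Family (suc n)) (c : Fin n → Fin 3) {v u} →
  Witness (F ∘ suc) c v u → Witness F (zero ∷ c) (suc v) (suc u)
witness-lift-blank F c (u-meets , u≢0 , unique) = u-meets , u≢0 , λ
  { zero _ _ 0≡cu → u≢0 (sym 0≡cu)
  ; (suc w) w-meets w≢u → unique w w-meets (w≢u ∘ cong suc) }

-- The invariant of the sweep: last is the chain member reaching furthest right and
-- prev the member before it; intervals reaching (lo v ≤ hi w) any other member end
-- by hi prev, or before lo last when there is no relevant prev.
NoPrevious : ∀ {n} → Family n → (Fin n → Fin 3) → Fin n → Set
NoPrevious F c last =
  ∀ v w → c w ≢ zero → w ≢ last → lo (F v) ≤ hi (F w) → hi (F v) < lo (F last)

record Previous {n} (F : Family n) (c : Fin n → Fin 3) (last : Fin n) : Set where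
  field
    prev              : Fin n
    prev≢last         : prev ≢ last
    prev-coloured     : c prev ≢ zero
    prev≢last-colour  : c prev ≢ c last
    prev-sole         : ∀ w → w ≢ prev → c w ≡ c prev → hi (F w) < lo (F prev)
    lo-prev≤lo-last   : lo (F prev) ≤ lo (F last)
    reach-other       : ∀ v w → c w ≢ zero → w ≢ prev → w ≢ last →
                        lo (F v) ≤ hi (F w) → hi (F v) ≤ hi (F prev)
    reach-prev-colour : ∀ v w → c w ≡ c prev → w ≢ prev →
                        lo (F v) ≤ hi (F w) → hi (F v) < lo (F last)

record Colouring {n} (F : Family n) : Set where
  field
    colour        : Fin n → Fin 3
    witness       : ∀ v → ∃ (Witness F colour v)
    last          : Fin n
    hi≤hi-last    : ∀ v → hi (F v) ≤ hi (F last)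
    last-coloured : colour last ≢ zero
    last-sole     : ∀ w → w ≢ last → colour w ≡ colour last → hi (F w) < lo (F last)
    previous      : NoPrevious F colour last ⊎ Previous F colour last

module Insert {n} (F : Family (suc (suc n)))
              (lo≤lo-new : ∀ v → lo (F v) ≤ lo (F zero))
              (old : Colouring (F ∘ suc)) where
  open Colouring old

  Lx Hx : ℚ
  Lx = lo (F zero)
  Hx = hi (F zero)

  before-new : ∀ u {w} → hi (F w) < lo (F u) → hi (F w) < Lx
  before-new u w<u = <-≤-trans w<u (lo≤lo-new u)

  hi≤hi-new : hi (F (suc last)) < Hx → ∀ v → hi (F v) ≤ Hx
  hi≤hi-new t<x zero = ≤-refl
  hi≤hi-new t<x (suc v) = <⇒≤ (≤-<-trans (hi≤hi-last v) t<x)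

  meets-last : ∀ v → Lx ≤ hi (F (suc v)) → Meets F (suc last) (suc v)
  meets-last v x≤v =
    ≤-trans (lo≤lo-new (suc last)) x≤v , ≤-trans (lo≤lo-new (suc v)) (≤-trans x≤v (hi≤hi-last v))

  Lx≤Hx : Lx ≤ Hx
  Lx≤Hx = lo≤hi (F zero)

  last-colour-coloured : ∀ {w} → colour w ≡ colour last → colour w ≢ zero
  last-colour-coloured cw≡ct = last-coloured ∘ trans (sym cw≡ct)

  append-new : (a : Fin 3) → a ≢ zero → a ≢ colour last → hi (F (suc last)) < Hx →
               (∀ w → colour w ≢ zero → w ≢ last → hi (F (suc w)) < Lx) →
               (∀ v w → colour w ≡ colour last → w ≢ last →
                  lo (F (suc v)) ≤ hi (F (suc w)) → hi (F (suc v)) < Lx) →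
               Colouring F
  append-new a a≢0 a≢ct t<x coloured-before-new reach-last-colour = record
    { colour = a ∷ colour
    ; witness = witness′
    ; last = zero
    ; hi≤hi-last = hi≤hi-new t<x
    ; last-coloured = a≢0
    ; last-sole = λ { zero 0≢0 → ⊥-elim (0≢0 refl) ; (suc w) _ cw≡a → a-before-new w cw≡a }
    ; previous = inj₂ record
      { prev = suc last
      ; prev≢last = λ ()
      ; prev-coloured = last-coloured
      ; prev≢last-colour = a≢ct ∘ sym
      ; prev-sole = λ { zero _ a≡ct → ⊥-elim (a≢ct a≡ct)
                      ; (suc w) w≢t → last-sole w (w≢t ∘ cong suc) }
      ; lo-prev≤lo-last = lo≤lo-new (suc last)
      ; reach-other = reach-other′
      ; reach-prev-colour = reach-prev-colour′
      }
    }
    where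
    a-before-new : ∀ w → colour w ≡ a → hi (F (suc w)) < Lx
    a-before-new w cw≡a =
      coloured-before-new w (a≢0 ∘ trans (sym cw≡a)) λ { refl → a≢ct (sym cw≡a) }
    witness′ : ∀ v → ∃ (Witness F (a ∷ colour) v)
    witness′ zero = zero , Meets-refl F zero , a≢0 , λ
      { zero _ 0≢0 → ⊥-elim (0≢0 refl)
      ; (suc w) (_ , x≤w) _ cw≡a → ≤⇒≯ x≤w (a-before-new w cw≡a) }
    witness′ (suc v) with Lx ≤? hi (F (suc v))
    ... | yes x≤v = suc last , meets-last v x≤v , last-coloured , λ
      { zero _ _ a≡ct → a≢ct a≡ct
      ; (suc w) (_ , v≤w) w≢t cw≡ct → ≤⇒≯ x≤v (reach-last-colour v w cw≡ct (w≢t ∘ cong suc) v≤w) }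
    ... | no x≰v = let (u , u-witness) = witness v in
      suc u , witness-lift-disjoint F a colour (ends-before⇒¬Meets F (≰⇒> x≰v)) u-witness
    reach-other′ : ∀ v w → (a ∷ colour) w ≢ zero → w ≢ suc last → w ≢ zero →
                   lo (F v) ≤ hi (F w) → hi (F v) ≤ hi (F (suc last))
    reach-other′ v zero _ _ 0≢0 = ⊥-elim (0≢0 refl)
    reach-other′ zero (suc w) w≢0 w≢t _ x≤w =
      ⊥-elim (≤⇒≯ x≤w (coloured-before-new w w≢0 (w≢t ∘ cong suc)))
    reach-other′ (suc v) (suc w) _ _ _ _ = hi≤hi-last v
    reach-prev-colour′ : ∀ v w → (a ∷ colour) w ≡ colour last → w ≢ suc last →
                         lo (F v) ≤ hi (F w) → hi (F v) < Lx
    reach-prev-colour′ v zero a≡ct = ⊥-elim (a≢ct a≡ct)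
    reach-prev-colour′ zero (suc w) cw≡ct w≢t x≤w =
      ⊥-elim (≤⇒≯ x≤w (before-new (suc last) (last-sole w (w≢t ∘ cong suc) cw≡ct)))
    reach-prev-colour′ (suc v) (suc w) cw≡ct w≢t = reach-last-colour v w cw≡ct (w≢t ∘ cong suc)

  append-new-alone : NoPrevious (F ∘ suc) colour last → hi (F (suc last)) < Hx → Colouring F
  append-new-alone none t<x =
    append-new (otherColour (colour last)) (otherColour≢0 _) (otherColour≢ _) t<x
      (λ w w≢0 w≢t → before-new (suc last) (none w w w≢0 w≢t (lo≤hi (F (suc w)))))
      (λ v w cw≡ct w≢t → before-new (suc last) ∘ none v w (last-colour-coloured cw≡ct) w≢t)

  module _ (P : Previous (F ∘ suc) colour last) where
    open Previous P

    last-colour≢prev : ∀ {w} → colour w ≡ colour last → w ≢ prev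
    last-colour≢prev cw≡ct refl = prev≢last-colour cw≡ct

    coloured-before-new : ∀ w → colour w ≢ zero → w ≢ prev → w ≢ last → hi (F (suc w)) < Lx
    coloured-before-new w w≢0 w≢s w≢t
      with nonzero-colour-cases (colour last) (colour prev) (colour w)
             last-coloured prev-coloured (prev≢last-colour ∘ sym) w≢0
    ... | inj₁ cw≡ct = before-new (suc last) (last-sole w w≢t cw≡ct)
    ... | inj₂ cw≡cs = before-new (suc prev) (prev-sole w w≢s cw≡cs)

    append-new-after-prev : hi (F (suc last)) < Hx → hi (F (suc prev)) < Lx → Colouring F
    append-new-after-prev t<x s<x =
      append-new (colour prev) prev-coloured prev≢last-colour t<x coloured-before-new′
        λ v w cw≡ct w≢t v≤w →
          ≤-<-trans
            (reach-other v w (last-colour-coloured cw≡ct) (last-colour≢prev cw≡ct) w≢t v≤w) s<x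
      where
      coloured-before-new′ : ∀ w → colour w ≢ zero → w ≢ last → hi (F (suc w)) < Lx
      coloured-before-new′ w w≢0 w≢t with w ≟ prev
      ... | yes refl = s<x
      ... | no w≢s = coloured-before-new w w≢0 w≢s w≢t

    replace-last : hi (F (suc last)) < Hx → Lx ≤ hi (F (suc prev)) → Colouring F
    replace-last t<x x≤s = record
      { colour = colour′
      ; witness = witness′
      ; last = zero
      ; hi≤hi-last = hi≤hi-new t<x
      ; last-coloured = last-coloured
      ; last-sole = λ { zero 0≢0 → ⊥-elim (0≢0 refl) ; (suc w) _ → last-colour-before-new w }
      ; previous = inj₂ record
        { prev = suc prev
        ; prev≢last = λ ()
        ; prev-coloured = prev-coloured′
        ; prev≢last-colour = prev≢last-colour ∘ trans (sym blank-prev)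
        ; prev-sole = prev-sole′
        ; lo-prev≤lo-last = lo≤lo-new (suc prev)
        ; reach-other = reach-other′
        ; reach-prev-colour = reach-prev-colour′
        }
      }
      where
      colour′ : Fin (suc (suc n)) → Fin 3
      colour′ = colour last ∷ blank last colour

      blank-prev : blank last colour prev ≡ colour prev
      blank-prev = updateAt-minimal prev last colour prev≢last

      recoloured : ∀ w {q} → blank last colour w ≡ q → q ≢ zero → w ≢ last × colour w ≡ q
      recoloured w bw≡q q≢0 =
        let (w≢t , bw≡cw) = blank-≢0 last colour (q≢0 ∘ trans (sym bw≡q))
        in w≢t , trans (sym bw≡cw) bw≡q

      recoloured-prev : ∀ w → blank last colour w ≡ blank last colour prev → colour w ≡ colour prev
      recoloured-prev w bw≡bs = proj₂ (recoloured w (trans bw≡bs blank-prev) prev-coloured)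

      prev-coloured′ : blank last colour prev ≢ zero
      prev-coloured′ = prev-coloured ∘ trans (sym blank-prev)

      last≢prev-colour′ : colour last ≢ blank last colour prev
      last≢prev-colour′ ct≡bs = prev≢last-colour (trans (sym blank-prev) (sym ct≡bs))

      last-colour-before-new : ∀ w → blank last colour w ≡ colour last → hi (F (suc w)) < Lx
      last-colour-before-new w bw≡ct =
        let (w≢t , cw≡ct) = recoloured w bw≡ct last-coloured
        in before-new (suc last) (last-sole w w≢t cw≡ct)

      witness-reaching : ∀ v → Lx ≤ hi (F (suc v)) → ∃ (Witness F colour′ (suc v))
      witness-reaching v x≤v with lo (F (suc v)) ≤? hi (F (suc prev))
      ... | yes v≤s =
        suc prev , (≤-trans (lo≤lo-new (suc prev)) x≤v , v≤s) , prev-coloured′ , λ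
        { zero _ _ ct≡bs → last≢prev-colour′ ct≡bs
        ; (suc w) (_ , v≤w) w≢s bw≡bs →
            ≤⇒≯ x≤v (before-new (suc last)
              (reach-prev-colour v w (recoloured-prev w bw≡bs) (w≢s ∘ cong suc) v≤w)) }
      ... | no v≰s = zero , (x≤v , ≤-trans (lo≤lo-new (suc v)) Lx≤Hx) , last-coloured , λ
        { zero _ 0≢0 → ⊥-elim (0≢0 refl)
        ; (suc w) (_ , v≤w) _ bw≡ct →
            let (w≢t , cw≡ct) = recoloured w bw≡ct last-coloured
                v≤s = reach-other v w (last-colour-coloured cw≡ct) (last-colour≢prev cw≡ct) w≢t v≤w
            in ≤⇒≯ (lo≤hi (F (suc v))) (≤-<-trans v≤s (≰⇒> v≰s)) }

      -- If v's old witness was last, v meets prev: lo prev ≤ lo last ≤ hi v < lo x ≤ hi prev.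
      witness-far : ∀ v → hi (F (suc v)) < Lx → ∃ (Witness F colour′ (suc v))
      witness-far v v<x with witness v
      ... | u , u-witness with u ≟ last
      ...   | no u≢t =
        suc u , witness-lift-disjoint F _ _ disjoint (witness-blank (F ∘ suc) colour u≢t u-witness)
        where disjoint = ends-before⇒¬Meets F v<x
      ...   | yes refl = suc prev , (≤-trans lo-prev≤lo-last t≤v , <⇒≤ v<s) , prev-coloured′ , λ
        { zero x-meets _ _ → ends-before⇒¬Meets F v<x x-meets
        ; (suc w) (_ , v≤w) w≢s bw≡bs →
            ≤⇒≯ t≤v (reach-prev-colour v w (recoloured-prev w bw≡bs) (w≢s ∘ cong suc) v≤w) }
        where
        t≤v = proj₁ (proj₁ u-witness)
        v<s = ≤-<-trans (lo≤hi (F (suc v))) (<-≤-trans v<x x≤s)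

      witness′ : ∀ v → ∃ (Witness F colour′ v)
      witness′ zero = zero , Meets-refl F zero , last-coloured , λ
        { zero _ 0≢0 → ⊥-elim (0≢0 refl)
        ; (suc w) (_ , x≤w) _ bw≡ct → ≤⇒≯ x≤w (last-colour-before-new w bw≡ct) }
      witness′ (suc v) with Lx ≤? hi (F (suc v))
      ... | yes x≤v = witness-reaching v x≤v
      ... | no x≰v = witness-far v (≰⇒> x≰v)

      prev-sole′ : ∀ w → w ≢ suc prev → colour′ w ≡ colour′ (suc prev) →
                   hi (F w) < lo (F (suc prev))
      prev-sole′ zero _ ct≡bs = ⊥-elim (last≢prev-colour′ ct≡bs)
      prev-sole′ (suc w) w≢s bw≡bs = prev-sole w (w≢s ∘ cong suc) (recoloured-prev w bw≡bs)

      reach-other′ : ∀ v w → colour′ w ≢ zero → w ≢ suc prev → w ≢ zero →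
                     lo (F v) ≤ hi (F w) → hi (F v) ≤ hi (F (suc prev))
      reach-other′ v zero _ _ 0≢0 = ⊥-elim (0≢0 refl)
      reach-other′ v (suc w) bw≢0 w≢s _ v≤w with blank-≢0 last colour bw≢0
      ... | w≢t , bw≡cw with v
      ...   | zero =
        ⊥-elim (≤⇒≯ v≤w (coloured-before-new w (bw≢0 ∘ trans bw≡cw) (w≢s ∘ cong suc) w≢t))
      ...   | suc v = reach-other v w (bw≢0 ∘ trans bw≡cw) (w≢s ∘ cong suc) w≢t v≤w

      reach-prev-colour′ : ∀ v w → colour′ w ≡ colour′ (suc prev) → w ≢ suc prev →
                           lo (F v) ≤ hi (F w) → hi (F v) < Lx
      reach-prev-colour′ v zero ct≡bs = ⊥-elim (last≢prev-colour′ ct≡bs)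
      reach-prev-colour′ zero (suc w) bw≡bs w≢s x≤w =
        ⊥-elim (≤⇒≯ x≤w (before-new (suc prev)
          (prev-sole w (w≢s ∘ cong suc) (recoloured-prev w bw≡bs))))
      reach-prev-colour′ (suc v) (suc w) bw≡bs w≢s v≤w =
        before-new (suc last) (reach-prev-colour v w (recoloured-prev w bw≡bs) (w≢s ∘ cong suc) v≤w)

  blank-new : Hx ≤ hi (F (suc last)) → Colouring F
  blank-new x≤t = record
    { colour = zero ∷ colour
    ; witness = λ { zero → suc last , witness-new
                  ; (suc v) → let (u , u-witness) = witness v
                              in suc u , witness-lift-blank F colour u-witness }
    ; last = suc last
    ; hi≤hi-last = λ { zero → x≤t ; (suc v) → hi≤hi-last v }
    ; last-coloured = last-coloured
    ; last-sole = λ { zero _ 0≡ct → ⊥-elim (last-coloured (sym 0≡ct))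
                    ; (suc w) w≢t → last-sole w (w≢t ∘ cong suc) }
    ; previous = ⊎-map no-previous previous′ previous
    }
    where
    witness-new : Witness F (zero ∷ colour) zero (suc last)
    witness-new = (≤-trans (lo≤lo-new (suc last)) Lx≤Hx , ≤-trans Lx≤Hx x≤t) , last-coloured , λ
      { zero _ _ 0≡ct → last-coloured (sym 0≡ct)
      ; (suc w) (_ , x≤w) w≢t cw≡ct →
          ≤⇒≯ x≤w (before-new (suc last) (last-sole w (w≢t ∘ cong suc) cw≡ct)) }
    no-previous : NoPrevious (F ∘ suc) colour last → NoPrevious F (zero ∷ colour) (suc last)
    no-previous none v zero 0≢0 = ⊥-elim (0≢0 refl)
    no-previous none zero (suc w) w≢0 w≢t x≤w =
      ⊥-elim (≤⇒≯ x≤w (before-new (suc last) (none w w w≢0 (w≢t ∘ cong suc) (lo≤hi (F (suc w))))))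
    no-previous none (suc v) (suc w) w≢0 w≢t = none v w w≢0 (w≢t ∘ cong suc)
    previous′ : Previous (F ∘ suc) colour last → Previous F (zero ∷ colour) (suc last)
    previous′ P = record
      { prev = suc prev
      ; prev≢last = prev≢last ∘ suc-injective
      ; prev-coloured = prev-coloured
      ; prev≢last-colour = prev≢last-colour
      ; prev-sole = λ { zero _ 0≡cs → ⊥-elim (prev-coloured (sym 0≡cs))
                      ; (suc w) w≢s → prev-sole w (w≢s ∘ cong suc) }
      ; lo-prev≤lo-last = lo-prev≤lo-last
      ; reach-other = reach-other′
      ; reach-prev-colour = reach-prev-colour′
      }
      where
      open Previous P
      reach-other′ : ∀ v w → (zero ∷ colour) w ≢ zero → w ≢ suc prev → w ≢ suc last →
                     lo (F v) ≤ hi (F w) → hi (F v) ≤ hi (F (suc prev))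
      reach-other′ v zero 0≢0 = ⊥-elim (0≢0 refl)
      reach-other′ zero (suc w) w≢0 w≢s w≢t x≤w =
        ⊥-elim (≤⇒≯ x≤w (coloured-before-new P w w≢0 (w≢s ∘ cong suc) (w≢t ∘ cong suc)))
      reach-other′ (suc v) (suc w) w≢0 w≢s w≢t =
        reach-other v w w≢0 (w≢s ∘ cong suc) (w≢t ∘ cong suc)
      reach-prev-colour′ : ∀ v w → (zero ∷ colour) w ≡ colour prev → w ≢ suc prev →
                           lo (F v) ≤ hi (F w) → hi (F v) < lo (F (suc last))
      reach-prev-colour′ v zero 0≡cs = ⊥-elim (prev-coloured (sym 0≡cs))
      reach-prev-colour′ zero (suc w) cw≡cs w≢s x≤w =
        ⊥-elim (≤⇒≯ x≤w (before-new (suc prev) (prev-sole w (w≢s ∘ cong suc) cw≡cs)))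
      reach-prev-colour′ (suc v) (suc w) cw≡cs w≢s = reach-prev-colour v w cw≡cs (w≢s ∘ cong suc)

  insert : Colouring F
  insert with Hx ≤? hi (F (suc last)) | previous
  ... | yes x≤t | _ = blank-new x≤t
  ... | no x≰t | inj₁ none = append-new-alone none (≰⇒> x≰t)
  ... | no x≰t | inj₂ P with Lx ≤? hi (F (suc (Previous.prev P)))
  ...   | yes x≤s = replace-last P (≰⇒> x≰t) x≤s
  ...   | no x≰s = append-new-after-prev P (≰⇒> x≰t) (≰⇒> x≰s)

singleton : (F : Family 1) → Colouring F
singleton F = record
  { colour = λ _ → suc zero
  ; witness = λ { zero → zero , Meets-refl F zero , (λ ()) , λ { zero _ 0≢0 → ⊥-elim (0≢0 refl) } }
  ; last = zero
  ; hi≤hi-last = λ { zero → ≤-refl }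
  ; last-coloured = λ ()
  ; last-sole = λ { zero 0≢0 → ⊥-elim (0≢0 refl) }
  ; previous = inj₁ λ { v zero _ 0≢0 → ⊥-elim (0≢0 refl) }
  }

colouring : ∀ {n} (F : Family (suc n)) → Descending ≤-totalPreorder (lo ∘ F) → Colouring F
colouring {zero} F _ = singleton F
colouring {suc n} F (lo≤lo-first , sorted) =
  Insert.insert F lo≤lo-first (colouring (F ∘ suc) sorted)

lemma4 : (n : ℕ) (F : Family n) → Σ (Fin n → Fin 3) (ClosedConflictFree 3 F)
lemma4 zero F = (λ ()) , λ ()
lemma4 (suc n) F =
  let (π , sorted) = sortDescending ≤-totalPreorder (lo ∘ F)
      open Colouring (colouring (F ∘ (π ⟨$⟩ʳ_)) sorted)
  in colour ∘ (π ⟨$⟩ˡ_) , witness⇒closedConflictFree F _ (witness-relabel π F colour witness)
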